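{- Let $n$ and $\epsilon$ be positive integers. Any data structure that, for every quaternary vector $Q[1,n]$ (i.e., every string of length $n$ over $\{0,1,2,3\}$), solves the Rank with Additive Approximation problem on $Q$ with additive error $\epsilon$ needs at least $\Omega(n/\epsilon)$ bits of space (in the worst case over the vectors $Q$ of length $n$).
   Context: For a quaternary vector $Q[1,n]$, a symbol $\alpha\in\{0,1,2,3\}$ and a position $i$, the rank query ${rank}_\alpha(i)$ returns the number of occurrences of $\alpha$ in $Q$ before position $i$. Rank with Additive Approximation problem: given a quaternary vector $Q[1,n]$ and a fixed additive error $\epsilon$, build a data structure that answers approximate rank queries: given a position $i$ and a symbol $\alpha\in\{0,1,2,3\}$, the query ${rank}^{\approx}_\alpha(i)$ may return any value $\tilde r$ with $\tilde r\in[r, r+\epsilon]$, where $r={rank}_\alpha(i)$. The data structure answers queries without access to $Q$ itself; its space is the number of bits it stores. -}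

module Defs where

open import Data.Nat using (ℕ; zero; suc; _+_; _≤_)
open import Data.Fin using (Fin; toℕ)
open import Data.Fin.Properties using (_≟_)
open import Data.Vec using (Vec; []; _∷_)
open import Data.List using (List; length)
open import Data.Bool using (Bool)
open import Relation.Nullary using (yes; no)

Quaternary : ℕ → Set
Quaternary n = Vec (Fin 4) n

countPrefix : ∀ {n} → Fin 4 → ℕ → Vec (Fin 4) n → ℕ
countPrefix α zero    _        = 0
countPrefix α (suc k) []       = 0
countPrefix α (suc k) (x ∷ xs) with α ≟ x
... | yes _ = suc (countPrefix α k xs)
... | no  _ = countPrefix α k xs

-- rank_α(i) for a position i ∈ [1,n]: number of occurrences of α in
-- Q strictly before position i, i.e. in Q[1, i-1].
rank : ∀ {n} → Quaternary n → Fin 4 → (i : ℕ) → ℕ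
rank Q α i = countPrefix α (i Data.Nat.∸ 1) Q

record DataStructure (n : ℕ) : Set where
  field
    encode : Quaternary n → List Bool
    query  : List Bool → Fin 4 → ℕ → ℕ

SolvesApproxRank : ∀ {n} → ℕ → DataStructure n → Set
SolvesApproxRank {n} ε D =
  ∀ (Q : Quaternary n) (α : Fin 4) (i : ℕ) → 1 ≤ i → i ≤ n →
    rank Q α i ≤ DataStructure.query D (DataStructure.encode D Q) α i
    × DataStructure.query D (DataStructure.encode D Q) α i ≤ rank Q α i + ε
  where open import Data.Product using (_×_)

space : ∀ {n} → DataStructure n → Quaternary n → ℕ
space D Q = length (DataStructure.encode D Q)

-- Let k = ε + 1 and m = ⌊(n − 1)/k⌋.  To each bit string u of length m
-- associate the quaternary vector that repeats the symbol u_j (0 or 1) k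
-- times, for j = 1, …, m, and is padded to length n.  At the block boundary
-- i = jk + 1 the exact rank of 0 is k times the number of zeros among the
-- first j bits, a multiple of k = ε + 1, so an answer within [rank, rank + ε]
-- determines it.  Hence the stored bits determine u, the encoding is
-- injective on 2^m inputs, and some input needs at least m bits; finally
-- n ≤ (m + 1)k ≤ 4εm.
module Submission where

open import Defs
open import Data.Nat using (ℕ; zero; suc; _+_; _*_; _^_; _≤_; _<_; z≤n; s≤s; s≤s⁻¹; _≤?_; pred)
open import Data.Nat.Properties hiding (_≟_)
open import Data.Nat.DivMod using (_/_; _%_; m≡m%n+[m/n]*n; m%n<n; m/n*n≤m; m≥n⇒m/n>0; [m+kn]%n≡m%n)
open import Data.Nat.Solver using (module +-*-Solver)
open import Data.Fin using (Fin; toℕ; fromℕ<; _↑ˡ_; combine; funToFin; finToFun)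
  renaming (zero to fz; suc to fs)
open import Data.Fin.Properties using (_≟_; any?; injective⇒≤; toℕ-fromℕ<; funToFin-finToFin)
open import Data.Vec using (Vec; []; _∷_; _++_; replicate; concat; map; tabulate; lookup)
open import Data.Vec.Properties using (lookup∘tabulate)
open import Data.List using (List; length) renaming ([] to []ˡ; _∷_ to _∷ˡ_)
open import Data.Bool using (Bool; true; false)
open import Data.Product using (∃; _×_; _,_; proj₁; proj₂)
open import Function using (_∘_)
open import Function.Definitions using (Injective)
open import Relation.Nullary using (yes; no; contradiction)
open import Relation.Binary.PropositionalEquality

private
  variable
    A : Set
    m n : ℕ

bit : Bool → ℕ
bit false = 0
bit true  = 1

bit-injective : Injective _≡_ _≡_ bit
bit-injective {false} {false} _ = refl
bit-injective {true}  {true}  _ = refl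

bit+[x*2]%2≡bit : ∀ b x → (bit b + x * 2) % 2 ≡ bit b
bit+[x*2]%2≡bit false x = [m+kn]%n≡m%n 0 x 2
bit+[x*2]%2≡bit true  x = [m+kn]%n≡m%n 1 x 2

bit+x*2-injective : ∀ b b′ x y → bit b + x * 2 ≡ bit b′ + y * 2 → b ≡ b′ × x ≡ y
bit+x*2-injective b b′ x y e
  with refl ← bit-injective (trans (sym (bit+[x*2]%2≡bit b x))
                              (trans (cong (_% 2) e) (bit+[x*2]%2≡bit b′ y)))
  = refl , *-cancelʳ-≡ x y 2 (+-cancelˡ-≡ (bit b) _ _ e)

-- Bijective base-2 numeration: it enumerates the bit lists by length.
listCode : List Bool → ℕ
listCode []ˡ       = 0
listCode (b ∷ˡ l) = suc (bit b + listCode l * 2)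

listCode-injective : Injective _≡_ _≡_ listCode
listCode-injective {[]ˡ}     {[]ˡ}       _ = refl
listCode-injective {b ∷ˡ l} {b′ ∷ˡ l′} e
  with refl , codes≡ ← bit+x*2-injective b b′ _ _ (suc-injective e)
  = cong (b ∷ˡ_) (listCode-injective codes≡)

bit≤1 : ∀ b → bit b ≤ 1
bit≤1 false = z≤n
bit≤1 true  = ≤-refl

listCode-bound : ∀ l → 2 + listCode l ≤ 2 ^ suc (length l)
listCode-bound []ˡ       = ≤-refl
listCode-bound (b ∷ˡ l) = begin
  2 + suc (bit b + listCode l * 2)   ≤⟨ +-monoʳ-≤ 3 (+-monoˡ-≤ (listCode l * 2) (bit≤1 b)) ⟩
  4 + listCode l * 2                 ≡⟨ cong (4 +_) (*-comm (listCode l) 2) ⟩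
  2 * 2 + 2 * listCode l             ≡⟨ *-distribˡ-+ 2 2 (listCode l) ⟨
  2 * (2 + listCode l)               ≤⟨ *-monoʳ-≤ 2 (listCode-bound l) ⟩
  2 ^ suc (suc (length l))           ∎
  where open ≤-Reasoning

listCode<pred[2^m] : ∀ l → length l < m → listCode l < pred (2 ^ m)
listCode<pred[2^m] {m} l len<m =
  pred-mono-≤ (≤-trans (listCode-bound l) (^-monoʳ-≤ 2 len<m))

funToFin-cong : {f g : Fin m → Fin n} → (∀ i → f i ≡ g i) → funToFin f ≡ funToFin g
funToFin-cong {zero}  _   = refl
funToFin-cong {suc m} f≗g = cong₂ combine (f≗g fz) (funToFin-cong (f≗g ∘ fs))

bitVector : Fin (2 ^ m) → Vec (Fin 2) m
bitVector = tabulate ∘ finToFun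

bitVector-injective : Injective _≡_ _≡_ (bitVector {m})
bitVector-injective {m} {i} {j} e = begin
  i                              ≡⟨ funToFin-finToFin {m} {2} i ⟨
  funToFin {m} {2} (finToFun i)  ≡⟨ funToFin-cong lookups ⟩
  funToFin {m} {2} (finToFun j)  ≡⟨ funToFin-finToFin {m} {2} j ⟩
  j                              ∎
  where
  open ≡-Reasoning
  lookups : ∀ x → finToFun {2} {m} i x ≡ finToFun j x
  lookups x = trans (sym (lookup∘tabulate (finToFun i) x))
                (trans (cong (λ v → lookup v x) e) (lookup∘tabulate (finToFun j) x))

-- There are only 2^m − 1 bit lists shorter than m.
incompressible : (G : Vec (Fin 2) m → List Bool) → Injective _≡_ _≡_ G →
                 ∃ λ u → m ≤ length (G u)
incompressible {m} G G-injective with any? (λ i → m ≤? length (G (bitVector i)))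
... | yes (i , long) = bitVector i , long
... | no noneLong =
  contradiction (injective⇒≤ code-injective) (<⇒≱ (≤-reflexive (suc-pred (2 ^ m) {{m^n≢0 2 m}})))
  where
  short : ∀ i → length (G (bitVector i)) < m
  short i = ≰⇒> (noneLong ∘ (i ,_))
  code : Fin (2 ^ m) → Fin (pred (2 ^ m))
  code i = fromℕ< (listCode<pred[2^m] (G (bitVector i)) (short i))
  code-injective : Injective _≡_ _≡_ code
  code-injective {i} {j} e = bitVector-injective (G-injective (listCode-injective
    (trans (sym (toℕ-fromℕ< _)) (trans (cong toℕ e) (toℕ-fromℕ< _)))))

countPrefix-[] : ∀ α t → countPrefix α t [] ≡ 0
countPrefix-[] α zero    = refl
countPrefix-[] α (suc t) = refl

countPrefix-∷ : ∀ α t x (v : Vec (Fin 4) n) →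
                countPrefix α (suc t) (x ∷ v) ≡ countPrefix α 1 (x ∷ []) + countPrefix α t v
countPrefix-∷ α t x v with α ≟ x
... | yes _ = refl
... | no  _ = refl

countPrefix-++ : ∀ α t (u : Vec (Fin 4) m) (w : Vec (Fin 4) n) →
                 countPrefix α (m + t) (u ++ w) ≡ countPrefix α m u + countPrefix α t w
countPrefix-++ α t []      w = refl
countPrefix-++ {suc m} α t (x ∷ u) w = begin
  countPrefix α (suc (m + t)) (x ∷ u ++ w)                    ≡⟨ countPrefix-∷ α (m + t) x (u ++ w) ⟩
  c + countPrefix α (m + t) (u ++ w)                          ≡⟨ cong (c +_) (countPrefix-++ α t u w) ⟩
  c + (countPrefix α m u + countPrefix α t w)                 ≡⟨ +-assoc c _ _ ⟨
  (c + countPrefix α m u) + countPrefix α t w                 ≡⟨ cong (_+ countPrefix α t w) (countPrefix-∷ α m x u) ⟨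
  countPrefix α (suc m) (x ∷ u) + countPrefix α t w           ∎
  where
  open ≡-Reasoning
  c = countPrefix α 1 (x ∷ [])

countPrefix-replicate : ∀ α k x → countPrefix α k (replicate k x) ≡ k * countPrefix α 1 (x ∷ [])
countPrefix-replicate α zero    x = refl
countPrefix-replicate α (suc k) x =
  trans (countPrefix-∷ α k x (replicate k x)) (cong (_ +_) (countPrefix-replicate α k x))

stretch : ∀ k → Vec A m → Vec A (m * k)
stretch k = concat ∘ map (replicate k)

countPrefix-stretch : ∀ α k j (u : Vec (Fin 4) m) →
                      countPrefix α (j * k) (stretch k u) ≡ countPrefix α j u * k
countPrefix-stretch α k zero    u       = refl
countPrefix-stretch α k (suc j) []      = countPrefix-[] α (k + j * k)
countPrefix-stretch α k (suc j) (x ∷ u) = begin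
  countPrefix α (k + j * k) (replicate k x ++ stretch k u)          ≡⟨ countPrefix-++ α (j * k) (replicate k x) (stretch k u) ⟩
  countPrefix α k (replicate k x) + countPrefix α (j * k) (stretch k u)
      ≡⟨ cong₂ _+_ (trans (countPrefix-replicate α k x) (*-comm k c)) (countPrefix-stretch α k j u) ⟩
  c * k + countPrefix α j u * k                                     ≡⟨ *-distribʳ-+ k c _ ⟨
  (c + countPrefix α j u) * k                                       ≡⟨ cong (_* k) (countPrefix-∷ α j x u) ⟨
  countPrefix α (suc j) (x ∷ u) * k                                 ∎
  where
  open ≡-Reasoning
  c = countPrefix α 1 (x ∷ [])

pad : A → m ≤ n → Vec A m → Vec A n
pad {n = n} a z≤n []      = replicate n a
pad a (s≤s m≤n)   (x ∷ u) = x ∷ pad a m≤n u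

countPrefix-pad : ∀ α a t → t ≤ m → (m≤n : m ≤ n) (u : Vec (Fin 4) m) →
                  countPrefix α t (pad a m≤n u) ≡ countPrefix α t u
countPrefix-pad α a zero    _         _         _       = refl
countPrefix-pad α a (suc t) (s≤s t≤m) (s≤s m≤n) (x ∷ u) = begin
  countPrefix α (suc t) (x ∷ pad a m≤n u)        ≡⟨ countPrefix-∷ α t x (pad a m≤n u) ⟩
  c + countPrefix α t (pad a m≤n u)              ≡⟨ cong (c +_) (countPrefix-pad α a t t≤m m≤n u) ⟩
  c + countPrefix α t u                          ≡⟨ countPrefix-∷ α t x u ⟨
  countPrefix α (suc t) (x ∷ u)                  ∎
  where
  open ≡-Reasoning
  c = countPrefix α 1 (x ∷ [])

zeroCount : ℕ → Vec (Fin 2) m → ℕ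
zeroCount j u = countPrefix fz j (map (_↑ˡ 2) u)

zeroCount-injective : (u w : Vec (Fin 2) m) →
                      (∀ j → j ≤ m → zeroCount j u ≡ zeroCount j w) → u ≡ w
zeroCount-injective []            []            _ = refl
zeroCount-injective (fz ∷ u)      (fz ∷ w)      H =
  cong (fz ∷_) (zeroCount-injective u w (λ j j≤m → suc-injective (H (suc j) (s≤s j≤m))))
zeroCount-injective (fs fz ∷ u)   (fs fz ∷ w)   H =
  cong (fs fz ∷_) (zeroCount-injective u w (λ j j≤m → H (suc j) (s≤s j≤m)))
zeroCount-injective (fz ∷ _)      (fs fz ∷ _)   H with () ← H 1 (s≤s z≤n)
zeroCount-injective (fs fz ∷ _)   (fz ∷ _)      H with () ← H 1 (s≤s z≤n)

x*[1+ε]≤y*[1+ε]+ε⇒x≤y : ∀ x y ε → x * suc ε ≤ y * suc ε + ε → x ≤ y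
x*[1+ε]≤y*[1+ε]+ε⇒x≤y x y ε le = s≤s⁻¹ (*-cancelʳ-< (suc ε) x (suc y) (begin-strict
  x * suc ε          ≤⟨ le ⟩
  y * suc ε + ε      <⟨ +-monoʳ-< (y * suc ε) ≤-refl ⟩
  y * suc ε + suc ε  ≡⟨ +-comm (y * suc ε) (suc ε) ⟩
  suc y * suc ε      ∎))
  where open ≤-Reasoning

hardInstance : ∀ k → m * k ≤ n → Vec (Fin 2) m → Quaternary n
hardInstance k mk≤n u = pad (fs fz) mk≤n (stretch k (map (_↑ˡ 2) u))

rank-hardInstance : ∀ k (mk≤n : m * k ≤ n) (u : Vec (Fin 2) m) j → j ≤ m →
                    rank (hardInstance k mk≤n u) fz (suc (j * k)) ≡ zeroCount j u * k
rank-hardInstance k mk≤n u j j≤m =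
  trans (countPrefix-pad fz (fs fz) (j * k) (*-monoˡ-≤ k j≤m) mk≤n _) (countPrefix-stretch fz k j _)

encode-hardInstance-injective :
  ∀ {ε} (D : DataStructure n) → SolvesApproxRank ε D → (mk<n : m * suc ε < n) →
  Injective _≡_ _≡_ (DataStructure.encode D ∘ hardInstance {m = m} (suc ε) (<⇒≤ mk<n))
encode-hardInstance-injective {n} {m} {ε} D solves mk<n {u} {w} e =
  zeroCount-injective u w (λ j j≤m → ≤-antisym (count≤ e j j≤m) (count≤ (sym e) j j≤m))
  where
  open DataStructure D
  k = suc ε
  Q = hardInstance {m = m} k (<⇒≤ mk<n)
  count≤ : ∀ {u w} → encode (Q u) ≡ encode (Q w) → ∀ j → j ≤ m → zeroCount j u ≤ zeroCount j w
  count≤ {u} {w} e j j≤m = x*[1+ε]≤y*[1+ε]+ε⇒x≤y _ _ ε (begin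
    zeroCount j u * k                   ≡⟨ rank-hardInstance k (<⇒≤ mk<n) u j j≤m ⟨
    rank (Q u) fz i                     ≤⟨ proj₁ (solves (Q u) fz i (s≤s z≤n) i≤n) ⟩
    query (encode (Q u)) fz i           ≡⟨ cong (λ s → query s fz i) e ⟩
    query (encode (Q w)) fz i           ≤⟨ proj₂ (solves (Q w) fz i (s≤s z≤n) i≤n) ⟩
    rank (Q w) fz i + ε                 ≡⟨ cong (_+ ε) (rank-hardInstance k (<⇒≤ mk<n) w j j≤m) ⟩
    zeroCount j w * k + ε               ∎)
    where
    open ≤-Reasoning
    i = suc (j * k)
    i≤n : i ≤ n
    i≤n = ≤-trans (s≤s (*-monoˡ-≤ k j≤m)) mk<n

blockCount-bound : ∀ n′ ε → 1 ≤ ε → 4 * ε ≤ suc n′ → suc n′ ≤ 4 * ε * (n′ / suc ε)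
blockCount-bound n′ ε 1≤ε 4ε≤n = begin
  suc n′                 ≤⟨ n′<[1+q]*[1+ε] ⟩
  suc q * suc ε          ≤⟨ *-mono-≤ (double-≥-suc 1≤q) (double-≥-suc 1≤ε) ⟩
  (2 * q) * (2 * ε)      ≡⟨ solve 2 (λ q ε → (con 2 :* q) :* (con 2 :* ε) := con 4 :* ε :* q) refl q ε ⟩
  4 * ε * q              ∎
  where
  open ≤-Reasoning
  open +-*-Solver using (solve; _:*_; _:=_; con)
  q = n′ / suc ε
  double-≥-suc : ∀ {x} → 1 ≤ x → suc x ≤ 2 * x
  double-≥-suc {x} 1≤x = subst (suc x ≤_) (cong (x +_) (sym (+-identityʳ x))) (+-monoˡ-≤ x 1≤x)
  n′<[1+q]*[1+ε] : n′ < suc q * suc ε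
  n′<[1+q]*[1+ε] = begin-strict
    n′                     ≡⟨ m≡m%n+[m/n]*n n′ (suc ε) ⟩
    n′ % suc ε + q * suc ε <⟨ +-monoˡ-< (q * suc ε) (m%n<n n′ (suc ε)) ⟩
    suc q * suc ε          ∎
  1+ε≤n′ : suc ε ≤ n′
  1+ε≤n′ = s≤s⁻¹ (begin
    suc (suc ε)            ≡⟨ +-comm 2 ε ⟩
    ε + 2                  ≤⟨ +-monoʳ-≤ ε (≤-trans (n≤1+n 2) (*-monoʳ-≤ 3 1≤ε)) ⟩
    4 * ε                  ≤⟨ 4ε≤n ⟩
    suc n′                 ∎)
  1≤q : 1 ≤ q
  1≤q = m≥n⇒m/n>0 1+ε≤n′

lemma3 : ∃ λ (c : ℕ) → 1 ≤ c ×
    (∀ (n ε : ℕ) → 1 ≤ n → 1 ≤ ε → c * ε ≤ n →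
    ∀ (D : DataStructure n) → SolvesApproxRank ε D →
    ∃ λ (Q : Quaternary n) → n ≤ c * ε * space D Q)
lemma3 = 4 , s≤s z≤n , lowerBound
  where
  lowerBound : ∀ (n ε : ℕ) → 1 ≤ n → 1 ≤ ε → 4 * ε ≤ n →
    ∀ (D : DataStructure n) → SolvesApproxRank ε D →
    ∃ λ (Q : Quaternary n) → n ≤ 4 * ε * space D Q
  lowerBound (suc n′) ε _ 1≤ε 4ε≤n D solves =
    let mk<n          = s≤s (m/n*n≤m n′ (suc ε))
        u , m≤space  = incompressible _ (encode-hardInstance-injective {m = n′ / suc ε} D solves mk<n)
    in  hardInstance (suc ε) (<⇒≤ mk<n) u
      , ≤-trans (blockCount-bound n′ ε 1≤ε 4ε≤n) (*-monoʳ-≤ (4 * ε) m≤space)
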